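{- Let $r\ge 2$ and $n$ be integers and let $s$ be an integer with $1\le s\le (1-\frac1r)n$. Then the edge set of any $r$-graph $G$ with $n$ vertices can be decomposed (partitioned) into $t$ subgraphs $G_1,\dots,G_t$, each of which is an $r$-partite $r$-graph contained in a copy of $K_r(s)$ (i.e., each $G_i$ is $r$-partite with vertex classes of size at most $s$), where \[ t\le \Big(\frac{n}{s}\Big)^r\lceil c\log n\rceil, \qquad c=c(r)=\frac{ -r}{\log\!\big(1-r!/r^r\big)}. \]
   Context: An $r$-graph on a vertex set $X$ is a collection of $r$-element subsets of $X$ (edges). An $r$-partite $r$-graph is an $r$-graph together with a partition of its vertex set into $r$ classes such that every edge contains exactly one vertex from each class. $K_r(s)$ denotes the complete $r$-partite $r$-graph with $s$ vertices in each class. Logarithms are base $2$. -}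

module Defs where

open import Data.Nat using (ℕ; _*_; _^_; _∸_; _≤_; _<_; _!)
open import Data.Fin using (Fin)
open import Data.Fin.Subset using (Subset; ∣_∣; _∩_; Empty)
open import Data.Product using (_×_)
open import Relation.Nullary using (¬_)
open import Relation.Binary.PropositionalEquality using (_≡_)

-- IsCeilCLog r n K  :⇔  K = ⌈ c(r) · log n ⌉  with  c(r) = -r / log(1 - r!/r^r).
-- Since c(r) log n = log_q (n^r) with q = r^r / (r^r - r!) > 1,
-- K is the least natural number with q^K ≥ n^r, i.e.
-- n^r · (r^r - r!)^K ≤ (r^r)^K.   (valid for n ≥ 1, r ≥ 2)
CeilCond : ℕ → ℕ → ℕ → Set
CeilCond r n K = n ^ r * (r ^ r ∸ r !) ^ K ≤ (r ^ r) ^ K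

IsCeilCLog : ℕ → ℕ → ℕ → Set
IsCeilCLog r n K = CeilCond r n K × (∀ k → k < K → ¬ CeilCond r n k)

-- V : Fin r → Subset n describes r vertex classes of a copy of K_r(s)
-- (pairwise disjoint, each of size at most s).
IsKrsFrame : (r n s : ℕ) → (Fin r → Subset n) → Set
IsKrsFrame r n s V =
  (∀ i j → ¬ (i ≡ j) → Empty (V i ∩ V j)) × (∀ j → ∣ V j ∣ ≤ s)

Crossing : {r n : ℕ} → (Fin r → Subset n) → Subset n → Set
Crossing V e = ∀ j → ∣ e ∩ V j ∣ ≡ 1

module Submission where

-- The proof derandomises a random colouring argument.  A colouring c of the n vertices
-- with r colours makes an r-set rainbow (all colours distinct) for exactly r! r^(n-r) of
-- the r^n colourings, so on average a fraction D / R, with D = r^r - r! and R = r^r, of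
-- any list of r-sets stays non-rainbow.  Picking greedily a colouring that does at least
-- as well as the average, K rounds make every r-set of [n] rainbow for one of the chosen
-- colourings, because there are fewer than n^r r-sets and n^r D^K ≤ R^K by the choice
-- of K = ⌈c log n⌉ (rainbow-cover).  For a single colouring, the vertices of colour i
-- are cut into ⌊a_i / s⌋ + 1 consecutive blocks of at most s vertices; one block of each
-- colour gives a copy of K_r(s) (a frame), every rainbow r-set crosses one frame, and as
-- Σ (a_i + s) = n + r s ≤ r n, AM–GM bounds the number ∏ (⌊a_i / s⌋ + 1) of frames by
-- (n / s)^r (length-frames).

open import Defs
open import Data.Nat using (ℕ; _*_; _^_; _∸_; _≤_)
open import Data.Fin using (Fin)
open import Data.Fin.Subset using (Subset; ∣_∣)
open import Data.Product using (_×_; ∃-syntax; Σ-syntax)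
open import Function.Definitions using (Injective)
open import Relation.Binary.PropositionalEquality using (_≡_)

open import Data.Nat.Properties hiding (_≟_)
open import Algebra.Properties.Semiring.Sum +-*-semiring
  using (sum; sum-cong-≗; sum-replicate-zero; ∑-distrib-+; *-distribʳ-sum)
open import Algebra.Properties.Monoid.Sum *-1-monoid using () renaming (sum to ∏)
open import Algebra.Properties.CommutativeSemigroup *-commutativeSemigroup using (x∙yz≈y∙xz; xy∙z≈xz∙y)
open import Data.Bool using (Bool; true; false; not; _∧_; if_then_else_; T)
open import Data.Empty using (⊥-elim)
open import Data.Fin using (zero; suc)
open import Data.Fin.Properties using (_≟_)
open import Data.Fin.Subset using (_∩_; ⊤; Empty) renaming (⊥ to ∅; _∈_ to _∈ₛ_)
open import Data.Fin.Subset.Properties using (∣p∣≤n; ∣⊥∣≡0; ∣⊤∣≡n; x∈p∩q⁻)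
open import Data.List using (List; []; _∷_; _++_; length; map; filterᵇ; concatMap; upTo)
import Data.List as List
open import Data.List.Membership.Propositional using (_∈_; find; lose)
open import Data.List.Membership.Propositional.Properties
  using (∈-∃++; ∈-map⁺; ∈-map⁻; ∈-++⁺ˡ; ∈-++⁺ʳ; ∈-++⁻; ∈-filter⁺; ∈-filter⁻; ∈-concatMap⁺; ∈-concatMap⁻; ∈-upTo⁺; ∈-lookup)
open import Data.List.Properties using (length-++; length-map; length-upTo; length-tabulate)
open import Data.List.Relation.Binary.Permutation.Propositional using (_↭_; ↭-trans; prep)
open import Data.List.Relation.Binary.Permutation.Propositional.Properties using (shift; ↭-length)
open import Data.List.Relation.Unary.All using (All; []; _∷_; all?)
open import Data.List.Relation.Unary.All.Properties using (¬All⇒Any¬)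
open import Data.List.Relation.Unary.Any as Any using (Any; here; there)
open import Data.List.Relation.Unary.Any.Properties using (lookup-index; concatMap⁺)
open import Data.Nat using (NonZero; >-nonZero; zero; suc; _+_; _⊔_; _<_; _≤?_; _<?_; z≤n; s≤s; s≤s⁻¹; pred; _!)
open import Data.Nat.DivMod using (_/_; _%_; m≡m%n+[m/n]*n; m%n<n; m/n*n≤m; /-monoˡ-≤)
import Data.Nat.ListAction as L
open import Data.Nat.ListAction.Properties using (sum-↭; product-↭)
open import Data.Product using (_,_; ∃; ∃₂; proj₁; proj₂)
open import Data.Sum using (inj₁; inj₂)
open import Data.Unit using (tt)
open import Data.Vec using (Vec; []; _∷_; lookup; tabulate) renaming (there to thereᵥ)
open import Data.Vec.Properties using (lookup∘tabulate)
open import Function using (_∘_)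
open import Relation.Binary.PropositionalEquality using (refl; sym; trans; cong; cong₂; subst; module ≡-Reasoning)
open import Relation.Nullary using (yes; no; ¬_; does; contradiction)

∑-mono-≤ : ∀ {k} {f g : Fin k → ℕ} → (∀ i → f i ≤ g i) → sum f ≤ sum g
∑-mono-≤ {zero}  f≤g = z≤n
∑-mono-≤ {suc k} f≤g = +-mono-≤ (f≤g zero) (∑-mono-≤ (λ i → f≤g (suc i)))

∑-const : ∀ k C → sum {k} (λ _ → C) ≡ k * C
∑-const zero    C = refl
∑-const (suc k) C = cong (C +_) (∑-const k C)

∃-≤-average : ∀ {k} (f : Fin k → ℕ) C → 1 ≤ k → sum f ≤ k * C → ∃ λ i → f i ≤ C
∃-≤-average {suc k} f C _ Σ≤ with f zero ≤? C
... | yes f₀≤C = zero , f₀≤C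
... | no  f₀≰C with k
...   | zero   = ⊥-elim (f₀≰C (≤-trans (m≤m+n (f zero) 0) (subst (sum f ≤_) (+-identityʳ C) Σ≤)))
...   | suc k′ =
  let i , fᵢ≤C = ∃-≤-average (λ i → f (suc i)) C (s≤s z≤n)
                   (+-cancelˡ-≤ C _ _ (≤-trans (+-monoˡ-≤ _ (<⇒≤ (≰⇒> f₀≰C))) Σ≤))
  in suc i , fᵢ≤C

all-one : ∀ {k} (f : Fin k → ℕ) → (∀ i → f i ≤ 1) → k ≤ sum f → ∀ i → f i ≡ 1
all-one {suc k} f f≤1 k≤Σ zero    = ≤-antisym (f≤1 zero) (+-cancelʳ-≤ k 1 (f zero) (≤-trans k≤Σ (+-monoʳ-≤ (f zero) rest≤k)))
  where
  rest≤k : sum (λ i → f (suc i)) ≤ k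
  rest≤k = ≤-trans (∑-mono-≤ (λ i → f≤1 (suc i))) (≤-reflexive (trans (∑-const k 1) (*-identityʳ k)))
all-one {suc k} f f≤1 k≤Σ (suc i) =
  all-one (λ i → f (suc i)) (λ i → f≤1 (suc i)) (s≤s⁻¹ (≤-trans k≤Σ (+-monoˡ-≤ _ (f≤1 zero)))) i

+-≤-multiple : ∀ r n {x} → 1 ≤ r → x ≤ (r ∸ 1) * n → n + x ≤ r * n
+-≤-multiple (suc r) n _ x≤ = +-monoʳ-≤ n x≤

∏-scale : ∀ k (f : Fin k → ℕ) s → ∏ (λ i → s * f i) ≡ s ^ k * ∏ f
∏-scale zero    f s = refl
∏-scale (suc k) f s =
  trans (cong (s * f zero *_) (∏-scale k (λ i → f (suc i)) s))
        ([m*n]*[o*p]≡[m*o]*[n*p] s (f zero) (s ^ k) (∏ (λ i → f (suc i))))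

-- AM–GM over ℕ: numbers with average at most n have product at most n ^ (their number).
-- Proof by smoothing: a term z > n and a term w ≤ n are replaced by n and z + w - n.

pick : ∀ {P : ℕ → Set} {xs : List ℕ} → Any P xs → ∃₂ λ z rest → P z × xs ↭ z ∷ rest
pick p
  with z , z∈xs , pz ← find p
  with ys , zs , refl ← ∈-∃++ z∈xs
  = z , ys ++ zs , pz , shift z ys zs

product-≤-pow : ∀ {n} xs → All (_≤ n) xs → L.product xs ≤ n ^ length xs
product-≤-pow []       []           = ≤-refl
product-≤-pow (x ∷ xs) (x≤n ∷ xs≤n) = *-mono-≤ x≤n (product-≤-pow xs xs≤n)

sum-≥ : ∀ {n} xs → All (n <_) xs → length xs * suc n ≤ L.sum xs
sum-≥ []       []          = z≤n
sum-≥ (x ∷ xs) (n<x ∷ n<xs) = +-mono-≤ n<x (sum-≥ xs n<xs)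

smoothing : ∀ n z w → n < z → w ≤ n → z * w ≤ n * (z + w ∸ n)
smoothing n z w n<z w≤n with d , refl ← m≤n⇒∃[o]m+o≡n (<⇒≤ n<z)
  rewrite +-assoc n d w | m+n∸m≡n n (d + w) = begin
  (n + d) * w     ≡⟨ *-distribʳ-+ w n d ⟩
  n * w + d * w   ≤⟨ +-monoʳ-≤ (n * w) (*-monoʳ-≤ d w≤n) ⟩
  n * w + d * n   ≡⟨ cong (n * w +_) (*-comm d n) ⟩
  n * w + n * d   ≡⟨ sym (*-distribˡ-+ n w d) ⟩
  n * (w + d)     ≡⟨ cong (n *_) (+-comm w d) ⟩
  n * (d + w)     ∎
  where open ≤-Reasoning

unbalanced : ∀ n k xs → length xs ≡ suc k → L.sum xs ≤ suc k * n → ¬ All (_≤ n) xs →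
             ∃₂ λ z w → ∃ λ zs → n < z × w ≤ n × xs ↭ z ∷ w ∷ zs
unbalanced n k xs len Σ≤ ¬all≤
  with z , ys , n<z , xs↭ ← pick (Any.map ≰⇒> (¬All⇒Any¬ (_≤? n) xs ¬all≤))
  with all? (n <?_) ys
... | no ¬all>
  with w , zs , w≤n , ys↭ ← pick (Any.map ≮⇒≥ (¬All⇒Any¬ (n <?_) ys ¬all>))
  = z , w , zs , n<z , w≤n , ↭-trans xs↭ (prep z ys↭)
... | yes all> = ⊥-elim (<⇒≱ too-big Σ≤)
  where
  |ys|≡k : length ys ≡ k
  |ys|≡k = suc-injective (trans (sym (↭-length xs↭)) len)
  too-big : suc k * n < L.sum xs
  too-big = begin-strict
    n + k * n           <⟨ +-mono-<-≤ (n<1+n n) (*-monoʳ-≤ k (n≤1+n n)) ⟩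
    suc n + k * suc n   ≤⟨ +-mono-≤ n<z (subst (λ j → j * suc n ≤ L.sum ys) |ys|≡k (sum-≥ ys all>)) ⟩
    z + L.sum ys        ≡⟨ sym (sum-↭ xs↭) ⟩
    L.sum xs            ∎
    where open ≤-Reasoning

amgm : ∀ n k (xs : List ℕ) → length xs ≡ k → L.sum xs ≤ k * n → L.product xs ≤ n ^ k
amgm n zero    []  _   _  = ≤-refl
amgm n (suc k) xs  len Σ≤ with all? (_≤? n) xs
... | yes all≤ = subst (λ j → L.product xs ≤ n ^ j) len (product-≤-pow xs all≤)
... | no ¬all≤
  with z , w , zs , n<z , w≤n , xs↭ ← unbalanced n k xs len Σ≤ ¬all≤ = begin
  L.product xs                    ≡⟨ product-↭ xs↭ ⟩
  z * (w * L.product zs)          ≡⟨ sym (*-assoc z w _) ⟩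
  z * w * L.product zs            ≤⟨ *-monoˡ-≤ _ (smoothing n z w n<z w≤n) ⟩
  n * (z + w ∸ n) * L.product zs  ≡⟨ *-assoc n _ _ ⟩
  n * L.product ys                ≤⟨ *-monoʳ-≤ n (amgm n k ys |ys|≡k Σys≤) ⟩
  n * n ^ k                       ∎
  where
  open ≤-Reasoning
  ys = (z + w ∸ n) ∷ zs
  |ys|≡k : length ys ≡ k
  |ys|≡k = suc-injective (trans (sym (↭-length xs↭)) len)
  n≤z+w : n ≤ z + w
  n≤z+w = ≤-trans (<⇒≤ n<z) (m≤m+n z w)
  Σys≤ : L.sum ys ≤ k * n
  Σys≤ = begin
    z + w ∸ n + L.sum zs    ≡⟨ sym (+-∸-comm (L.sum zs) n≤z+w) ⟩
    z + w + L.sum zs ∸ n    ≡⟨ cong (_∸ n) (trans (+-assoc z w _) (sym (sum-↭ xs↭))) ⟩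
    L.sum xs ∸ n            ≤⟨ ∸-monoˡ-≤ n Σ≤ ⟩
    n + k * n ∸ n           ≡⟨ m+n∸m≡n n (k * n) ⟩
    k * n                   ∎

amgm-∏ : ∀ n k (f : Fin k → ℕ) → sum f ≤ k * n → ∏ f ≤ n ^ k
amgm-∏ n k f Σ≤ = subst (_≤ n ^ k) (product-tabulate k f)
  (amgm n k (List.tabulate f) (length-tabulate f) (subst (_≤ k * n) (sym (sum-tabulate k f)) Σ≤))
  where
  sum-tabulate : ∀ k (f : Fin k → ℕ) → L.sum (List.tabulate f) ≡ sum f
  sum-tabulate zero    f = refl
  sum-tabulate (suc k) f = cong (f zero +_) (sum-tabulate k (λ i → f (suc i)))
  product-tabulate : ∀ k (f : Fin k → ℕ) → L.product (List.tabulate f) ≡ ∏ f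
  product-tabulate zero    f = refl
  product-tabulate (suc k) f = cong (f zero *_) (product-tabulate k (λ i → f (suc i)))

-- The list of all k-element subsets of an n-set.  There are fewer than n ^ k of
-- them when n ≥ 1 and k ≥ 2; this is what makes the greedy covering terminate.

subsets : ∀ n → ℕ → List (Subset n)
subsets zero    zero    = [] ∷ []
subsets zero    (suc k) = []
subsets (suc n) zero    = map (false ∷_) (subsets n zero)
subsets (suc n) (suc k) = map (true ∷_) (subsets n k) ++ map (false ∷_) (subsets n (suc k))

subsets-sound : ∀ n k {e : Subset n} → e ∈ subsets n k → ∣ e ∣ ≡ k
subsets-sound zero    zero    (here refl) = refl
subsets-sound (suc n) zero    e∈ with _ , e′∈ , refl ← ∈-map⁻ (false ∷_) e∈ = subsets-sound n zero e′∈
subsets-sound (suc n) (suc k) e∈ with ∈-++⁻ (map (true ∷_) (subsets n k)) e∈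
... | inj₁ e∈₁ with _ , e′∈ , refl ← ∈-map⁻ (true ∷_) e∈₁ = cong suc (subsets-sound n k e′∈)
... | inj₂ e∈₂ with _ , e′∈ , refl ← ∈-map⁻ (false ∷_) e∈₂ = subsets-sound n (suc k) e′∈

subsets-complete : ∀ n k (e : Subset n) → ∣ e ∣ ≡ k → e ∈ subsets n k
subsets-complete zero    zero    []          _ = here refl
subsets-complete (suc n) zero    (false ∷ e) ∣e∣≡0 = ∈-map⁺ (false ∷_) (subsets-complete n zero e ∣e∣≡0)
subsets-complete (suc n) (suc k) (true ∷ e)  ∣e∣≡k =
  ∈-++⁺ˡ (∈-map⁺ (true ∷_) (subsets-complete n k e (suc-injective ∣e∣≡k)))
subsets-complete (suc n) (suc k) (false ∷ e) ∣e∣≡k =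
  ∈-++⁺ʳ (map (true ∷_) (subsets n k)) (∈-map⁺ (false ∷_) (subsets-complete n (suc k) e ∣e∣≡k))

length-subsets-pascal : ∀ n k → length (subsets (suc n) (suc k)) ≡ length (subsets n k) + length (subsets n (suc k))
length-subsets-pascal n k =
  trans (length-++ (map (true ∷_) (subsets n k))) (cong₂ _+_ (length-map _ (subsets n k)) (length-map _ (subsets n (suc k))))

pow-pascal : ∀ n k → n ^ k + n ^ suc k ≤ suc n ^ suc k
pow-pascal n k = +-mono-≤ (^-monoˡ-≤ k (n≤1+n n)) (*-monoʳ-≤ n (^-monoˡ-≤ k (n≤1+n n)))

length-subsets-≤ : ∀ n k → length (subsets n k) ≤ n ^ k
length-subsets-≤ zero    zero    = ≤-refl
length-subsets-≤ zero    (suc k) = z≤n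
length-subsets-≤ (suc n) zero    = ≤-trans (≤-reflexive (length-map _ (subsets n zero))) (length-subsets-≤ n zero)
length-subsets-≤ (suc n) (suc k) = begin
  length (subsets (suc n) (suc k))                    ≡⟨ length-subsets-pascal n k ⟩
  length (subsets n k) + length (subsets n (suc k))   ≤⟨ +-mono-≤ (length-subsets-≤ n k) (length-subsets-≤ n (suc k)) ⟩
  n ^ k + n ^ suc k                                   ≤⟨ pow-pascal n k ⟩
  suc n ^ suc k                                       ∎
  where open ≤-Reasoning

length-subsets-< : ∀ n k → length (subsets (suc n) (suc (suc k))) < suc n ^ suc (suc k)
length-subsets-< zero    k = subst (0 <_) (sym (^-zeroˡ (suc (suc k)))) (s≤s z≤n)
length-subsets-< (suc n) k = begin-strict
  length (subsets (suc (suc n)) (suc (suc k)))                               ≡⟨ length-subsets-pascal (suc n) (suc k) ⟩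
  length (subsets (suc n) (suc k)) + length (subsets (suc n) (suc (suc k)))  <⟨ +-mono-≤-< (length-subsets-≤ (suc n) (suc k)) (length-subsets-< n k) ⟩
  suc n ^ suc k + suc n ^ suc (suc k)                                        ≤⟨ pow-pascal (suc n) (suc k) ⟩
  suc (suc n) ^ suc (suc k)                                                  ∎
  where open ≤-Reasoning

length-concatMap-≡ : ∀ {A B : Set} (f : A → List B) xs P → (∀ x → length (f x) ≡ P) →
                     length (concatMap f xs) ≡ length xs * P
length-concatMap-≡ f []       P |f|≡P = refl
length-concatMap-≡ f (x ∷ xs) P |f|≡P = trans (length-++ (f x)) (cong₂ _+_ (|f|≡P x) (length-concatMap-≡ f xs P |f|≡P))

length-concatMap-≤ : ∀ {A B : Set} (f : A → List B) xs M N → (∀ x → length (f x) * M ≤ N) →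
                     length (concatMap f xs) * M ≤ length xs * N
length-concatMap-≤ f []       M N _      = z≤n
length-concatMap-≤ f (x ∷ xs) M N |f|M≤N = begin
  length (f x ++ concatMap f xs) * M               ≡⟨ cong (_* M) (length-++ (f x)) ⟩
  (length (f x) + length (concatMap f xs)) * M     ≡⟨ *-distribʳ-+ M (length (f x)) _ ⟩
  length (f x) * M + length (concatMap f xs) * M   ≤⟨ +-mono-≤ (|f|M≤N x) (length-concatMap-≤ f xs M N |f|M≤N) ⟩
  N + length xs * N                                ∎
  where open ≤-Reasoning

boxPoints : ∀ k → (Fin k → ℕ) → List (Vec ℕ k)
boxPoints zero    q = [] ∷ []
boxPoints (suc k) q = concatMap (λ b → map (b ∷_) (boxPoints k (λ i → q (suc i)))) (upTo (q zero))

length-boxPoints : ∀ k q → length (boxPoints k q) ≡ ∏ q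
length-boxPoints zero    q = refl
length-boxPoints (suc k) q =
  trans (length-concatMap-≡ _ (upTo (q zero)) _ rows) (cong (_* ∏ (λ i → q (suc i))) (length-upTo (q zero)))
  where
  rows : ∀ b → length (map (b ∷_) (boxPoints k (λ i → q (suc i)))) ≡ ∏ (λ i → q (suc i))
  rows b = trans (length-map (b ∷_) (boxPoints k (λ i → q (suc i)))) (length-boxPoints k (λ i → q (suc i)))

boxPoints-complete : ∀ k q (b : Vec ℕ k) → (∀ i → lookup b i < q i) → b ∈ boxPoints k q
boxPoints-complete zero    q []      _   = here refl
boxPoints-complete (suc k) q (x ∷ b) b<q = ∈-concatMap⁺ _ (lose (∈-upTo⁺ (b<q zero))
  (∈-map⁺ (x ∷_) (boxPoints-complete k (λ i → q (suc i)) b (λ i → b<q (suc i)))))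

-- Sums over all r ^ n colourings  c : Vec (Fin r) n  of n vertices with r colours.

module _ (r : ℕ) where

  ∑col : ∀ n → (Vec (Fin r) n → ℕ) → ℕ
  ∑col zero    g = g []
  ∑col (suc n) g = sum (λ x → ∑col n (λ c → g (x ∷ c)))

  ∑col-cong : ∀ n {f g : Vec (Fin r) n → ℕ} → (∀ c → f c ≡ g c) → ∑col n f ≡ ∑col n g
  ∑col-cong zero    f≡g = f≡g []
  ∑col-cong (suc n) f≡g = sum-cong-≗ (λ x → ∑col-cong n (λ c → f≡g (x ∷ c)))

  ∑col-+ : ∀ n (f g : Vec (Fin r) n → ℕ) → ∑col n (λ c → f c + g c) ≡ ∑col n f + ∑col n g
  ∑col-+ zero    f g = refl
  ∑col-+ (suc n) f g = trans (sum-cong-≗ (λ x → ∑col-+ n (λ c → f (x ∷ c)) (λ c → g (x ∷ c)))) 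
                             (∑-distrib-+ (λ x → ∑col n (λ c → f (x ∷ c))) (λ x → ∑col n (λ c → g (x ∷ c))))

  ∑col-*ʳ : ∀ n (f : Vec (Fin r) n → ℕ) C → ∑col n (λ c → f c * C) ≡ ∑col n f * C
  ∑col-*ʳ zero    f C = refl
  ∑col-*ʳ (suc n) f C =
    trans (sum-cong-≗ (λ x → ∑col-*ʳ n (λ c → f (x ∷ c)) C))
          (sym (*-distribʳ-sum C (λ x → ∑col n (λ c → f (x ∷ c)))))

  ∑col-const : ∀ n C → ∑col n (λ _ → C) ≡ r ^ n * C
  ∑col-const zero    C = sym (+-identityʳ C)
  ∑col-const (suc n) C =
    trans (sum-cong-≗ {r} (λ _ → ∑col-const n C)) (trans (∑-const r (r ^ n * C)) (sym (*-assoc r (r ^ n) C)))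

  ∃-≤-average-col : ∀ n (f : Vec (Fin r) n → ℕ) C → 1 ≤ r → ∑col n f ≤ r ^ n * C → ∃ λ c → f c ≤ C
  ∃-≤-average-col zero    f C _   Σ≤ = [] , subst (f [] ≤_) (+-identityʳ C) Σ≤
  ∃-≤-average-col (suc n) f C 1≤r Σ≤
    with x , Σₓ≤ ← ∃-≤-average (λ x → ∑col n (λ c → f (x ∷ c))) (r ^ n * C) 1≤r
                    (subst (∑col (suc n) f ≤_) (*-assoc r (r ^ n) C) Σ≤)
    with c , f≤ ← ∃-≤-average-col n (λ c → f (x ∷ c)) C 1≤r Σₓ≤
    = x ∷ c , f≤

-- For a set U of forbidden colours and a set e of
-- vertices, exactly (r - |U|)(r - |U| - 1)⋯ (|e| factors) out of every r ^ |e| colourings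
-- give the vertices of e distinct colours outside U.

𝟙 : Bool → ℕ
𝟙 true  = 1
𝟙 false = 0

𝟙-not : ∀ b → 𝟙 (not b) + 𝟙 b ≡ 1
𝟙-not true  = refl
𝟙-not false = refl

∑-𝟙-≟ : ∀ {k} (x : Fin k) → sum (λ i → 𝟙 (does (x ≟ i))) ≡ 1
∑-𝟙-≟ {suc k} zero    = cong suc (sum-replicate-zero k)
∑-𝟙-≟ {suc k} (suc x) = ∑-𝟙-≟ x

falling : ℕ → ℕ → ℕ
falling a zero    = 1
falling a (suc k) = a * falling (pred a) k

falling-self : ∀ a → falling a a ≡ a !
falling-self zero    = refl
falling-self (suc a) = cong (suc a *_) (falling-self a)

insert : ∀ {k} → Fin k → Subset k → Subset k
insert zero    (_ ∷ U) = true ∷ U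
insert (suc x) (b ∷ U) = b ∷ insert x U

insert-card : ∀ {k} (x : Fin k) U → lookup U x ≡ false → ∣ insert x U ∣ ≡ suc ∣ U ∣
insert-card zero    (false ∷ U) _    = refl
insert-card (suc x) (true  ∷ U) x∉U = cong suc (insert-card x U x∉U)
insert-card (suc x) (false ∷ U) x∉U = insert-card x U x∉U

insert-here : ∀ {k} (x : Fin k) U → lookup (insert x U) x ≡ true
insert-here zero    (_ ∷ U) = refl
insert-here (suc x) (_ ∷ U) = insert-here x U

insert-keep : ∀ {k} (x i : Fin k) U → lookup U i ≡ true → lookup (insert x U) i ≡ true
insert-keep zero    zero    (_ ∷ U) i∈U = refl
insert-keep zero    (suc i) (_ ∷ U) i∈U = i∈U
insert-keep (suc x) zero    (_ ∷ U) i∈U = i∈U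
insert-keep (suc x) (suc i) (_ ∷ U) i∈U = insert-keep x i U i∈U

∑-outside : ∀ {k} (U : Subset k) → sum (λ x → 𝟙 (not (lookup U x))) ≡ k ∸ ∣ U ∣
∑-outside []          = refl
∑-outside (true  ∷ U) = ∑-outside U
∑-outside (false ∷ U) = trans (cong suc (∑-outside U)) (sym (+-∸-assoc 1 (∣p∣≤n U)))

module _ (r : ℕ) where

  rainbowAvoiding : ∀ {n} → Subset r → Subset n → Vec (Fin r) n → Bool
  rainbowAvoiding U []          []      = true
  rainbowAvoiding U (true  ∷ e) (x ∷ c) = not (lookup U x) ∧ rainbowAvoiding (insert x U) e c
  rainbowAvoiding U (false ∷ e) (x ∷ c) = rainbowAvoiding U e c

  #rainbowAvoiding : ∀ n → Subset r → Subset n → ℕ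
  #rainbowAvoiding n U e = ∑col r n (λ c → 𝟙 (rainbowAvoiding U e c))

  -- Colourings giving the first vertex of e colour x, counted for the remaining vertices e.
  startingWith : ∀ n → Subset r → Subset n → Fin r → ℕ
  startingWith n U e x = ∑col r n (λ c → 𝟙 (not (lookup U x) ∧ rainbowAvoiding (insert x U) e c))

  startingWith-count : ∀ n U (e : Subset n) →
    (∀ U′ → #rainbowAvoiding n U′ e * r ^ ∣ e ∣ ≡ falling (r ∸ ∣ U′ ∣) ∣ e ∣ * r ^ n) →
    ∀ x → startingWith n U e x * r ^ ∣ e ∣ ≡ 𝟙 (not (lookup U x)) * (falling (r ∸ suc ∣ U ∣) ∣ e ∣ * r ^ n)
  startingWith-count n U e count x with lookup U x in x∈U
  ... | true  = cong (_* r ^ ∣ e ∣) (trans (∑col-const r n 0) (*-zeroʳ (r ^ n)))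
  ... | false = begin
    #rainbowAvoiding n (insert x U) e * r ^ ∣ e ∣  ≡⟨ count (insert x U) ⟩
    falling (r ∸ ∣ insert x U ∣) ∣ e ∣ * r ^ n     ≡⟨ cong (λ a → falling (r ∸ a) ∣ e ∣ * r ^ n) (insert-card x U x∈U) ⟩
    G                                              ≡⟨ sym (+-identityʳ G) ⟩
    1 * G                                          ∎
    where
    open ≡-Reasoning
    G = falling (r ∸ suc ∣ U ∣) ∣ e ∣ * r ^ n

  -- The count: #(good colourings) · r ^ |e| = falling (r - |U|) |e| · r ^ n.  Induction on the
  -- vertices; a vertex of e gets one of the r - |U| colours outside U, which is then forbidden.
  count-rainbowAvoiding : ∀ n U (e : Subset n) →
    #rainbowAvoiding n U e * r ^ ∣ e ∣ ≡ falling (r ∸ ∣ U ∣) ∣ e ∣ * r ^ n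
  count-rainbowAvoiding zero U [] = refl
  count-rainbowAvoiding (suc n) U (false ∷ e) = begin
    sum {r} (λ _ → #rainbowAvoiding n U e) * r ^ ∣ e ∣ ≡⟨ cong (_* r ^ ∣ e ∣) (∑-const r _) ⟩
    r * #rainbowAvoiding n U e * r ^ ∣ e ∣           ≡⟨ *-assoc r _ _ ⟩
    r * (#rainbowAvoiding n U e * r ^ ∣ e ∣)         ≡⟨ cong (r *_) (count-rainbowAvoiding n U e) ⟩
    r * (falling (r ∸ ∣ U ∣) ∣ e ∣ * r ^ n)          ≡⟨ x∙yz≈y∙xz r (falling (r ∸ ∣ U ∣) ∣ e ∣) (r ^ n) ⟩
    falling (r ∸ ∣ U ∣) ∣ e ∣ * (r * r ^ n)          ∎
    where open ≡-Reasoning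
  count-rainbowAvoiding (suc n) U (true ∷ e) = begin
    N * (r * r ^ ∣ e ∣)                        ≡⟨ x∙yz≈y∙xz N r _ ⟩
    r * (N * r ^ ∣ e ∣)                        ≡⟨ cong (r *_) by-first-colour ⟩
    r * ((r ∸ u) * (F′ * r ^ n))               ≡⟨ x∙yz≈y∙xz r (r ∸ u) _ ⟩
    (r ∸ u) * (r * (F′ * r ^ n))               ≡⟨ cong ((r ∸ u) *_) (x∙yz≈y∙xz r F′ (r ^ n)) ⟩
    (r ∸ u) * (F′ * (r * r ^ n))               ≡⟨ sym (*-assoc (r ∸ u) F′ _) ⟩
    (r ∸ u) * F′ * (r * r ^ n)                 ≡⟨ cong (λ a → (r ∸ u) * falling a ∣ e ∣ * (r * r ^ n)) (sym (pred[m∸n]≡m∸[1+n] r u)) ⟩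
    falling (r ∸ u) (suc ∣ e ∣) * (r * r ^ n)  ∎
    where
    open ≡-Reasoning
    u = ∣ U ∣
    N = #rainbowAvoiding (suc n) U (true ∷ e)
    F′ = falling (r ∸ suc u) ∣ e ∣
    by-first-colour : N * r ^ ∣ e ∣ ≡ (r ∸ u) * (F′ * r ^ n)
    by-first-colour = begin
      N * r ^ ∣ e ∣                                 ≡⟨ *-distribʳ-sum (r ^ ∣ e ∣) (startingWith n U e) ⟩
      sum (λ x → startingWith n U e x * r ^ ∣ e ∣)  ≡⟨ sum-cong-≗ (startingWith-count n U e (λ U′ → count-rainbowAvoiding n U′ e)) ⟩
      sum (λ x → 𝟙 (not (lookup U x)) * (F′ * r ^ n))
        ≡⟨ sym (*-distribʳ-sum (F′ * r ^ n) (λ x → 𝟙 (not (lookup U x)))) ⟩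
      sum (λ x → 𝟙 (not (lookup U x))) * (F′ * r ^ n)  ≡⟨ cong (_* (F′ * r ^ n)) (∑-outside U) ⟩
      (r ∸ u) * (F′ * r ^ n)                           ∎

  rainbow : ∀ {n} → Subset n → Vec (Fin r) n → Bool
  rainbow = rainbowAvoiding ∅

  -- R = r ^ r colourings of an r-set, D = r ^ r - r! of which are not rainbow.
  R D : ℕ
  R = r ^ r
  D = r ^ r ∸ r !

  #nonRainbow : ∀ n → Subset n → ℕ
  #nonRainbow n e = ∑col r n (λ c → 𝟙 (not (rainbow e c)))

  count-nonRainbow : ∀ n (e : Subset n) → ∣ e ∣ ≡ r → #nonRainbow n e * R ≡ r ^ n * D
  count-nonRainbow n e ∣e∣≡r = begin
    #nonRainbow n e * R                     ≡⟨ cong (_* R) (sym (m+n∸n≡m (#nonRainbow n e) #rb)) ⟩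
    (#nonRainbow n e + #rb ∸ #rb) * R       ≡⟨ cong (λ a → (a ∸ #rb) * R) total ⟩
    (r ^ n ∸ #rb) * R                       ≡⟨ *-distribʳ-∸ R (r ^ n) #rb ⟩
    r ^ n * R ∸ #rb * R                     ≡⟨ cong (r ^ n * R ∸_) rainbows ⟩
    r ^ n * R ∸ r ^ n * r !                 ≡⟨ sym (*-distribˡ-∸ (r ^ n) R (r !)) ⟩
    r ^ n * D                               ∎
    where
    open ≡-Reasoning
    #rb = #rainbowAvoiding n ∅ e
    total : #nonRainbow n e + #rb ≡ r ^ n
    total = begin
      #nonRainbow n e + #rb                               ≡⟨ sym (∑col-+ r n _ _) ⟩
      ∑col r n (λ c → 𝟙 (not (rainbow e c)) + 𝟙 (rainbow e c)) ≡⟨ ∑col-cong r n (λ c → 𝟙-not (rainbow e c)) ⟩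
      ∑col r n (λ _ → 1)                                  ≡⟨ trans (∑col-const r n 1) (*-identityʳ _) ⟩
      r ^ n                                               ∎
    rainbows : #rb * R ≡ r ^ n * r !
    rainbows = begin
      #rb * r ^ r                          ≡⟨ cong (λ k → #rb * r ^ k) (sym ∣e∣≡r) ⟩
      #rb * r ^ ∣ e ∣                      ≡⟨ count-rainbowAvoiding n ∅ e ⟩
      falling (r ∸ ∣ ∅ {r} ∣) ∣ e ∣ * r ^ n ≡⟨ cong₂ (λ a k → falling (r ∸ a) k * r ^ n) (∣⊥∣≡0 r) ∣e∣≡r ⟩
      falling r r * r ^ n                  ≡⟨ cong (_* r ^ n) (falling-self r) ⟩
      r ! * r ^ n                          ≡⟨ *-comm (r !) _ ⟩
      r ^ n * r !                          ∎

  nonRainbowIn : ∀ {n} → Vec (Fin r) n → List (Subset n) → List (Subset n)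
  nonRainbowIn c = filterᵇ (λ e → not (rainbow e c))

  length-nonRainbowIn : ∀ {n} (c : Vec (Fin r) n) e S →
    length (nonRainbowIn c (e ∷ S)) ≡ 𝟙 (not (rainbow e c)) + length (nonRainbowIn c S)
  length-nonRainbowIn c e S with rainbow e c
  ... | true  = refl
  ... | false = refl

  ∑col-nonRainbowIn : ∀ n (S : List (Subset n)) → (∀ {e} → e ∈ S → ∣ e ∣ ≡ r) →
    ∑col r n (λ c → length (nonRainbowIn c S) * R) ≡ length S * (r ^ n * D)
  ∑col-nonRainbowIn n []      _     = trans (∑col-const r n 0) (*-zeroʳ (r ^ n))
  ∑col-nonRainbowIn n (e ∷ S) sizes = begin
    ∑col r n (λ c → length (nonRainbowIn c (e ∷ S)) * R)
      ≡⟨ ∑col-cong r n (λ c → trans (cong (_* R) (length-nonRainbowIn c e S)) (*-distribʳ-+ R (𝟙 (not (rainbow e c))) _)) ⟩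
    ∑col r n (λ c → 𝟙 (not (rainbow e c)) * R + length (nonRainbowIn c S) * R)
      ≡⟨ ∑col-+ r n _ _ ⟩
    ∑col r n (λ c → 𝟙 (not (rainbow e c)) * R) + ∑col r n (λ c → length (nonRainbowIn c S) * R)
      ≡⟨ cong₂ _+_ (trans (∑col-*ʳ r n _ R) (count-nonRainbow n e (sizes (here refl))))
                   (∑col-nonRainbowIn n S (λ e∈S → sizes (there e∈S))) ⟩
    r ^ n * D + length S * (r ^ n * D) ∎
    where open ≡-Reasoning

  good-colouring : ∀ n (S : List (Subset n)) → 1 ≤ r → (∀ {e} → e ∈ S → ∣ e ∣ ≡ r) →
                   ∃ λ c → length (nonRainbowIn c S) * R ≤ length S * D
  good-colouring n S 1≤r sizes = ∃-≤-average-col r n _ (length S * D) 1≤r (≤-reflexive (begin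
    ∑col r n (λ c → length (nonRainbowIn c S) * R) ≡⟨ ∑col-nonRainbowIn n S sizes ⟩
    length S * (r ^ n * D)                         ≡⟨ x∙yz≈y∙xz (length S) (r ^ n) D ⟩
    r ^ n * (length S * D)                         ∎))
    where open ≡-Reasoning

  greedy-round : ∀ K a b → b * R ≤ a * D → a * D ^ suc K < R ^ suc K → b * D ^ K < R ^ K
  greedy-round K a b bR≤aD aDᴷ<Rᴷ = *-cancelʳ-< R _ _ (begin-strict
    b * D ^ K * R   ≡⟨ xy∙z≈xz∙y b (D ^ K) R ⟩
    b * R * D ^ K   ≤⟨ *-monoˡ-≤ (D ^ K) bR≤aD ⟩
    a * D * D ^ K   ≡⟨ *-assoc a D _ ⟩
    a * D ^ suc K   <⟨ aDᴷ<Rᴷ ⟩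
    R * R ^ K       ≡⟨ *-comm R _ ⟩
    R ^ K * R       ∎)
    where open ≤-Reasoning

  rainbow-cover : ∀ n K (S : List (Subset n)) → 1 ≤ r → (∀ {e} → e ∈ S → ∣ e ∣ ≡ r) →
    length S * D ^ K < R ^ K →
    ∃ λ (cs : List (Vec (Fin r) n)) → length cs ≤ K × (∀ {e} → e ∈ S → Any (λ c → rainbow e c ≡ true) cs)
  rainbow-cover n zero    []      _   _     _          = [] , z≤n , λ ()
  rainbow-cover n zero    (_ ∷ _) _   _     (s≤s ())
  rainbow-cover n (suc K) S       1≤r sizes |S|Dᴷ<Rᴷ
    with c , few ← good-colouring n S 1≤r sizes
    with cs , |cs|≤K , covered ← rainbow-cover n K (nonRainbowIn c S) 1≤r
                                   (λ e∈ → sizes (proj₁ (∈-filter⁻ _ e∈)))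
                                   (greedy-round K (length S) (length (nonRainbowIn c S)) few |S|Dᴷ<Rᴷ)
    = c ∷ cs , s≤s |cs|≤K , cover-S
    where
    cover-S : ∀ {e} → e ∈ S → Any (λ c′ → rainbow e c′ ≡ true) (c ∷ cs)
    cover-S {e} e∈S with rainbow e c in rb
    ... | true  = here rb
    ... | false = there (covered (∈-filter⁺ _ e∈S (subst (T ∘ not) (sym rb) tt)))

  colourCount : ∀ {n} → Fin r → Subset n → Vec (Fin r) n → ℕ
  colourCount i []          []      = 0
  colourCount i (true  ∷ e) (x ∷ c) = 𝟙 (does (x ≟ i)) + colourCount i e c
  colourCount i (false ∷ e) (x ∷ c) = colourCount i e c

  ∑-colourCount : ∀ {n} (e : Subset n) c → sum (λ i → colourCount i e c) ≡ ∣ e ∣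
  ∑-colourCount []          []      = sum-replicate-zero r
  ∑-colourCount (true  ∷ e) (x ∷ c) =
    trans (∑-distrib-+ (λ i → 𝟙 (does (x ≟ i))) (λ i → colourCount i e c))
          (cong₂ _+_ (∑-𝟙-≟ x) (∑-colourCount e c))
  ∑-colourCount (false ∷ e) (x ∷ c) = ∑-colourCount e c

  rainbowAvoiding-colourCount : ∀ {n} U (e : Subset n) c → rainbowAvoiding U e c ≡ true → ∀ i →
    (lookup U i ≡ true → colourCount i e c ≡ 0) × colourCount i e c ≤ 1
  rainbowAvoiding-colourCount U []          []      _  i = (λ _ → refl) , z≤n
  rainbowAvoiding-colourCount U (false ∷ e) (x ∷ c) ok i = rainbowAvoiding-colourCount U e c ok i
  rainbowAvoiding-colourCount U (true  ∷ e) (x ∷ c) ok i with lookup U x in x∈U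
  rainbowAvoiding-colourCount U (true  ∷ e) (x ∷ c) () i | true
  ... | false with rainbowAvoiding-colourCount (insert x U) e c ok i | x ≟ i
  ...   | absent , _   | yes refl = (λ x∈U′ → contradiction (trans (sym x∈U) x∈U′) λ ())
                                  , ≤-reflexive (cong suc (absent (insert-here x U)))
  ...   | absent , ≤1 | no  _    = (λ i∈U → absent (insert-keep x i U i∈U)) , ≤1

  rainbow-colourCount : ∀ {n} (e : Subset n) c → ∣ e ∣ ≡ r → rainbow e c ≡ true → ∀ i → colourCount i e c ≡ 1
  rainbow-colourCount e c ∣e∣≡r rb = all-one (λ i → colourCount i e c)
    (λ i → proj₂ (rainbowAvoiding-colourCount ∅ e c rb i))
    (≤-reflexive (sym (trans (∑-colourCount e c) ∣e∣≡r)))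

  -- Windows.  Number the vertices of colour i in order, starting from k; the window
  -- [L, H) is the set of colour-i vertices whose number lies in [L, H).

  inWindow : ℕ → ℕ → ℕ → Bool
  inWindow L H k with L ≤? k | k <? H
  ... | yes _ | yes _ = true
  ... | _     | _     = false

  window : ∀ {n} → Vec (Fin r) n → Fin r → ℕ → ℕ → ℕ → Subset n
  window []      i L H k = []
  window (x ∷ c) i L H k =
    if does (x ≟ i) then inWindow L H k ∷ window c i L H (suc k) else false ∷ window c i L H k

  rank : ∀ {n} → Fin r → Subset n → Vec (Fin r) n → ℕ → ℕ
  rank i []          []      k = k
  rank i (true  ∷ e) (x ∷ c) k = if does (x ≟ i) then k else rank i e c k
  rank i (false ∷ e) (x ∷ c) k = rank i e c (if does (x ≟ i) then suc k else k)

  inWindow-step : ∀ L H k → 𝟙 (inWindow L H k) + (H ∸ (suc k ⊔ L)) ≤ H ∸ (k ⊔ L)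
  inWindow-step L H k with L ≤? k | k <? H
  ... | yes L≤k | yes k<H rewrite m≥n⇒m⊔n≡m L≤k | m≥n⇒m⊔n≡m (m≤n⇒m≤1+n L≤k) =
    ≤-reflexive (sym (+-∸-assoc 1 k<H))
  ... | yes _   | no  _   = ∸-monoʳ-≤ H (⊔-monoˡ-≤ L (n≤1+n k))
  ... | no  _   | yes _   = ∸-monoʳ-≤ H (⊔-monoˡ-≤ L (n≤1+n k))
  ... | no  _   | no  _   = ∸-monoʳ-≤ H (⊔-monoˡ-≤ L (n≤1+n k))

  inWindow-true : ∀ L H k → L ≤ k → k < H → inWindow L H k ≡ true
  inWindow-true L H k L≤k k<H with L ≤? k | k <? H
  ... | yes _ | yes _ = refl
  ... | no  ¬L≤k | _       = contradiction L≤k ¬L≤k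
  ... | yes _    | no ¬k<H = contradiction k<H ¬k<H

  window-size : ∀ {n} (c : Vec (Fin r) n) i L H k → ∣ window c i L H k ∣ ≤ H ∸ (k ⊔ L)
  window-size []      i L H k = z≤n
  window-size (x ∷ c) i L H k with does (x ≟ i)
  ... | false = window-size c i L H k
  ... | true with inWindow L H k | window-size c i L H (suc k) | inWindow-step L H k
  ...   | true  | rest | step = ≤-trans (s≤s rest) step
  ...   | false | rest | step = ≤-trans rest step

  window-colour : ∀ {n} (c : Vec (Fin r) n) i L H k (v : Fin n) → v ∈ₛ window c i L H k → lookup c v ≡ i
  window-colour (x ∷ c) i L H k zero v∈ with x ≟ i
  ... | yes x≡i = x≡i
  window-colour (x ∷ c) i L H k zero () | no _
  window-colour (x ∷ c) i L H k (suc v) v∈ with does (x ≟ i)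
  window-colour (x ∷ c) i L H k (suc v) (thereᵥ v∈) | true  = window-colour c i L H (suc k) v v∈
  window-colour (x ∷ c) i L H k (suc v) (thereᵥ v∈) | false = window-colour c i L H k v v∈

  rank-bound : ∀ {n} i (e : Subset n) c k → colourCount i e c ≡ 1 → rank i e c k < k + colourCount i ⊤ c
  rank-bound i []         []      k ()
  rank-bound i (true ∷ e) (x ∷ c) k once with does (x ≟ i)
  ... | true  = m<m+n k (s≤s z≤n)
  ... | false = rank-bound i e c k once
  rank-bound i (false ∷ e) (x ∷ c) k once with does (x ≟ i)
  ... | true  = subst (rank i e c (suc k) <_) (sym (+-suc k _)) (rank-bound i e c (suc k) once)
  ... | false = rank-bound i e c k once

  window-miss : ∀ {n} i (e : Subset n) c L H k → colourCount i e c ≡ 0 → ∣ e ∩ window c i L H k ∣ ≡ 0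
  window-miss i []          []      L H k none = refl
  window-miss i (true  ∷ e) (x ∷ c) L H k none with does (x ≟ i)
  window-miss i (true  ∷ e) (x ∷ c) L H k () | true
  ... | false = window-miss i e c L H k none
  window-miss i (false ∷ e) (x ∷ c) L H k none with does (x ≟ i)
  ... | true  = window-miss i e c L H (suc k) none
  ... | false = window-miss i e c L H k none

  window-hit : ∀ {n} i (e : Subset n) c L H k → colourCount i e c ≡ 1 →
               L ≤ rank i e c k → rank i e c k < H → ∣ e ∩ window c i L H k ∣ ≡ 1
  window-hit i []          []      L H k () _ _
  window-hit i (true  ∷ e) (x ∷ c) L H k once L≤ <H with does (x ≟ i)
  ... | true rewrite inWindow-true L H k L≤ <H = cong suc (window-miss i e c L H (suc k) (suc-injective once))
  ... | false = window-hit i e c L H k once L≤ <H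
  window-hit i (false ∷ e) (x ∷ c) L H k once L≤ <H with does (x ≟ i)
  ... | true  = window-hit i e c L H (suc k) once L≤ <H
  ... | false = window-hit i e c L H k once L≤ <H

  -- Blocks and frames.  Cutting the numbered colour-i vertices into consecutive blocks
  -- of s vertices, one block of every colour forms the vertex classes of a copy of K_r(s).
  module _ (s : ℕ) .{{_ : NonZero s}} where

    block : ∀ {n} → Vec (Fin r) n → Fin r → ℕ → Subset n
    block c i b = window c i (b * s) (b * s + s) 0

    frame : ∀ {n} → Vec (Fin r) n → Vec ℕ r → Fin r → Subset n
    frame c b i = block c i (lookup b i)

    frame-isKrs : ∀ {n} c b → IsKrsFrame r n s (frame {n} c b)
    frame-isKrs c b = disjoint , small
      where
      disjoint : ∀ i j → ¬ i ≡ j → Empty (frame c b i ∩ frame c b j)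
      disjoint i j i≢j (v , v∈)
        with v∈i , v∈j ← x∈p∩q⁻ (frame c b i) (frame c b j) v∈
        = i≢j (trans (sym (window-colour c i _ _ 0 v v∈i)) (window-colour c j _ _ 0 v v∈j))
      small : ∀ j → ∣ frame c b j ∣ ≤ s
      small j = ≤-trans (window-size c j (lookup b j * s) (lookup b j * s + s) 0)
                        (≤-reflexive (m+n∸m≡n (lookup b j * s) s))

    -- The number of blocks of colour i (the last one possibly empty).
    #blocks : ∀ {n} → Vec (Fin r) n → Fin r → ℕ
    #blocks c i = suc (colourCount i ⊤ c / s)

    frames : ∀ {n} → Vec (Fin r) n → List (Fin r → Subset n)
    frames c = map (frame c) (boxPoints r (#blocks c))

    frames-isKrs : ∀ {n} (c : Vec (Fin r) n) {V} → V ∈ frames c → IsKrsFrame r n s V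
    frames-isKrs c V∈ with b , _ , refl ← ∈-map⁻ (frame c) V∈ = frame-isKrs c b

    blocksOf : ∀ {n} → Subset n → Vec (Fin r) n → Vec ℕ r
    blocksOf e c = tabulate (λ i → rank i e c 0 / s)

    <-next-multiple : ∀ m → m < m / s * s + s
    <-next-multiple m = begin-strict
      m                 ≡⟨ m≡m%n+[m/n]*n m s ⟩
      m % s + m / s * s <⟨ +-monoˡ-< (m / s * s) (m%n<n m s) ⟩
      s + m / s * s     ≡⟨ +-comm s _ ⟩
      m / s * s + s     ∎
      where open ≤-Reasoning

    blocksOf-crossing : ∀ {n} (e : Subset n) c → ∣ e ∣ ≡ r → rainbow e c ≡ true → Crossing (frame c (blocksOf e c)) e
    blocksOf-crossing e c ∣e∣≡r rb j rewrite lookup∘tabulate (λ i → rank i e c 0 / s) j =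
      window-hit j e c _ _ 0 (rainbow-colourCount e c ∣e∣≡r rb j) (m/n*n≤m (rank j e c 0) s) (<-next-multiple (rank j e c 0))

    blocksOf-inBox : ∀ {n} (e : Subset n) c → ∣ e ∣ ≡ r → rainbow e c ≡ true → ∀ i → lookup (blocksOf e c) i < #blocks c i
    blocksOf-inBox e c ∣e∣≡r rb i rewrite lookup∘tabulate (λ i → rank i e c 0 / s) i =
      s≤s (/-monoˡ-≤ s (<⇒≤ (rank-bound i e c 0 (rainbow-colourCount e c ∣e∣≡r rb i))))

    frames-cross : ∀ {n} (e : Subset n) c → ∣ e ∣ ≡ r → rainbow e c ≡ true → Any (λ V → Crossing V e) (frames c)
    frames-cross e c ∣e∣≡r rb = lose
      (∈-map⁺ (frame c) (boxPoints-complete r (#blocks c) (blocksOf e c) (blocksOf-inBox e c ∣e∣≡r rb)))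
      (blocksOf-crossing e c ∣e∣≡r rb)

    blocks-bound : ∀ a → s * suc (a / s) ≤ a + s
    blocks-bound a = begin
      s * suc (a / s)     ≡⟨ *-suc s (a / s) ⟩
      s + s * (a / s)     ≡⟨ cong (s +_) (*-comm s (a / s)) ⟩
      s + a / s * s       ≤⟨ +-monoʳ-≤ s (m/n*n≤m a s) ⟩
      s + a               ≡⟨ +-comm s a ⟩
      a + s               ∎
      where open ≤-Reasoning

    -- By AM–GM, a colouring has at most (n / s) ^ r frames when r s ≤ (r - 1) n.
    length-frames : ∀ {n} (c : Vec (Fin r) n) → 1 ≤ r → r * s ≤ (r ∸ 1) * n → length (frames c) * s ^ r ≤ n ^ r
    length-frames {n} c 1≤r rs≤ = begin
      length (frames c) * s ^ r                ≡⟨ cong (_* s ^ r) (trans (length-map (frame c) (boxPoints r (#blocks c)))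
                                                                          (length-boxPoints r (#blocks c))) ⟩
      ∏ (#blocks c) * s ^ r                    ≡⟨ trans (*-comm _ (s ^ r)) (sym (∏-scale r (#blocks c) s)) ⟩
      ∏ (λ i → s * #blocks c i)                ≤⟨ amgm-∏ n r _ total ⟩
      n ^ r                                    ∎
      where
      open ≤-Reasoning
      total : sum (λ i → s * #blocks c i) ≤ r * n
      total = begin
        sum (λ i → s * #blocks c i)                        ≤⟨ ∑-mono-≤ (λ i → blocks-bound (colourCount i ⊤ c)) ⟩
        sum (λ i → colourCount i ⊤ c + s)                  ≡⟨ ∑-distrib-+ (λ i → colourCount i ⊤ c) (λ _ → s) ⟩
        sum (λ i → colourCount i ⊤ c) + sum {r} (λ _ → s)  ≡⟨ cong₂ _+_ (trans (∑-colourCount ⊤ c) (∣⊤∣≡n n)) (∑-const r s) ⟩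
        n + r * s                                          ≤⟨ +-≤-multiple r n 1≤r rs≤ ⟩
        r * n                                              ∎

-- a < b and b x ≤ y with y > 0 give a x < y.  With a the number of r-sets, b = n ^ r and
-- x = D ^ K, y = R ^ K, this is the budget that lets K greedy rounds cover every r-set.
<-·-≤ : ∀ {a b x y} → a < b → b * x ≤ y → 0 < y → a * x < y
<-·-≤ {a} {x = zero} {y} _   _    0<y = subst (_< y) (sym (*-zeroʳ a)) 0<y
<-·-≤ {x = suc x}         a<b bx≤y _   = <-≤-trans (*-monoˡ-< (suc x) a<b) bx≤y

frame-decomposition : ∀ r n s .{{_ : NonZero s}} K → 2 ≤ r → r * s ≤ (r ∸ 1) * n → CeilCond r n K →
  ∃ λ (F : List (Fin r → Subset n)) →
    (∀ {V} → V ∈ F → IsKrsFrame r n s V) ×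
    (∀ (e : Subset n) → ∣ e ∣ ≡ r → Any (λ V → Crossing V e) F) ×
    length F * s ^ r ≤ n ^ r * K
frame-decomposition (suc zero) _ _ _ (s≤s ()) _ _
frame-decomposition (suc (suc _)) zero s K _ _ _ = [] , (λ ()) , (λ { [] () }) , z≤n
frame-decomposition r@(suc (suc r″)) n@(suc n′) s K _ rs≤ n^rDᴷ≤Rᴷ
  with cs , |cs|≤K , covered ← rainbow-cover r n K (subsets n r) (s≤s z≤n) (subsets-sound n r)
                                  (<-·-≤ (length-subsets-< n′ r″) n^rDᴷ≤Rᴷ (m^n>0 (R r) {{m^n≢0 r r}} K))
  = F , isKrs , cross , bound
  where
  F = concatMap (frames r s) cs
  isKrs : ∀ {V} → V ∈ F → IsKrsFrame r n s V
  isKrs V∈F with c , _ , V∈ ← find (∈-concatMap⁻ (frames r s) {cs} V∈F) = frames-isKrs r s c V∈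
  cross : ∀ e → ∣ e ∣ ≡ r → Any (λ V → Crossing V e) F
  cross e ∣e∣≡r = concatMap⁺ (frames r s)
    (Any.map (λ {c} → frames-cross r s e c ∣e∣≡r) (covered (subsets-complete n r e ∣e∣≡r)))
  bound : length F * s ^ r ≤ n ^ r * K
  bound = begin
    length F * s ^ r    ≤⟨ length-concatMap-≤ (frames r s) cs (s ^ r) (n ^ r) (λ c → length-frames r s c (s≤s z≤n) rs≤) ⟩
    length cs * n ^ r   ≤⟨ *-monoˡ-≤ (n ^ r) |cs|≤K ⟩
    K * n ^ r           ≡⟨ *-comm K (n ^ r) ⟩
    n ^ r * K           ∎
    where open ≤-Reasoning

-- The decomposition: G_i consists of the edges k with φ k = i; each is crossing, so G_i is
-- r-partite with the classes V i of a copy of K_r(s).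
lemma10 : (r n s : ℕ) → 2 ≤ r → 1 ≤ s → r * s ≤ (r ∸ 1) * n →
          (K : ℕ) → IsCeilCLog r n K →
          (m : ℕ) (E : Fin m → Subset n) → Injective _≡_ _≡_ E →
          (∀ k → ∣ E k ∣ ≡ r) →
          ∃[ t ] Σ[ φ ∈ (Fin m → Fin t) ] Σ[ V ∈ (Fin t → Fin r → Subset n) ]
            ((∀ (i : Fin t) → IsKrsFrame r n s (V i)) ×
             (∀ (k : Fin m) → Crossing (V (φ k)) (E k)) ×
             t * s ^ r ≤ n ^ r * K)
lemma10 r n s 2≤r 1≤s rs≤ K (n^rDᴷ≤Rᴷ , _) m E _ ∣E∣≡r
  with F , isKrs , cross , bound ← frame-decomposition r n s {{>-nonZero 1≤s}} K 2≤r rs≤ n^rDᴷ≤Rᴷ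
  = length F
  , (λ k → Any.index (cross (E k) (∣E∣≡r k)))
  , List.lookup F
  , (λ i → isKrs (∈-lookup i))
  , (λ k → lookup-index (cross (E k) (∣E∣≡r k)))
  , bound
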